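{- For every integer $t$, the number of $a$-valid sequences with at most $t$ digits is $a_t-1$.
   Context: Fix nonnegative integers $\lambda_1,\lambda_2,\dots$ and an integer $k\ge1$ (the order) such that $\lambda_1\ge1$, $\lambda_k\ge1$, $\lambda_i=0$ for $i>k$, and $\lambda_1\ge2$ if $k=1$. Define $(a_n)_{n\in\mathbb Z}$ by $a_n=1$ for $n\le0$ and $a_n=\sum_{i=1}^k\lambda_ia_{n-i}$ for $n\ge1$. Let $\Lambda_j=\sum_{i=1}^j\lambda_i$ for $j\ge0$, $\Lambda=\Lambda_k$, and for $0\le\ell<\Lambda$ let $\mu_\ell$ be the least $j$ with $\Lambda_j>\ell$. A digit sequence $d_M,d_{M-1},\dots,d_0$ (with $M\ge0$, so $M+1$ digits) is $a$-valid if: $0\le d_i<\Lambda$ for all $i$; $d_M\ne0$; and whenever $d_i=\ell$ with $i<M$, we have $d_{i+1}=d_{i+2}=\dots=d_{i+\mu_\ell-1}=0$. -}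

module Defs where

open import Data.Bool using (Bool; true; false; if_then_else_)
open import Data.Nat using (ℕ; zero; suc; _+_; _*_; _∸_; _≤_; _<_; _<ᵇ_; _<?_; _≟_)
open import Data.Integer using (ℤ; +_; -[1+_])
open import Data.Fin using (Fin; toℕ; fromℕ)
open import Data.Fin.Properties using (all?)
open import Data.Vec using (Vec; []; _∷_; lookup)
open import Data.List using (List; []; _∷_; [_]; length; filter; map; concatMap; allFin)
open import Data.Product using (_×_)
open import Relation.Nullary using (Dec; ¬_; ¬?; _×-dec_)
open import Relation.Nullary.Decidable using (_→-dec_)
open import Relation.Binary.PropositionalEquality using (_≡_)

sumTo : (ℕ → ℕ) → ℕ → ℕ
sumTo f zero    = 0
sumTo f (suc j) = sumTo f j + f (suc j)

-- Λ_j = Σ_{i=1}^{j} λ_i   (λ given as a function ℕ → ℕ, λ 0 unused)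
Lam : (ℕ → ℕ) → ℕ → ℕ
Lam lam j = sumTo lam j

LamTot : (ℕ → ℕ) → ℕ → ℕ
LamTot lam k = Lam lam k

μ-search : (ℕ → ℕ) → ℕ → ℕ → ℕ → ℕ
μ-search L ℓ j zero    = j
μ-search L ℓ j (suc f) = if ℓ <ᵇ L j then j else μ-search L ℓ (suc j) f

-- μ_ℓ = least j with Λ_j > ℓ (for ℓ < Λ = Λ_k this is found among 0..k)
μ : (ℕ → ℕ) → ℕ → ℕ → ℕ
μ lam k ℓ = μ-search (Lam lam) ℓ 0 k

-- The recurrence.  hist n = a_n ∷ a_{n-1} ∷ … ∷ a_0 ; entries with negative index are 1.
lookupD : List ℕ → ℕ → ℕ
lookupD []       _       = 1
lookupD (x ∷ xs) zero    = x
lookupD (x ∷ xs) (suc j) = lookupD xs j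

hist : (ℕ → ℕ) → ℕ → ℕ → List ℕ
hist lam k zero    = [ 1 ]
-- a_{n+1} = Σ_{i=1}^{k} λ_i a_{n+1-i},  and a_{n+1-i} is entry (i-1) of hist n
hist lam k (suc n) = sumTo (λ i → lam i * lookupD (hist lam k n) (i ∸ 1)) k ∷ hist lam k n

aℕ : (ℕ → ℕ) → ℕ → ℕ → ℕ
aℕ lam k n = lookupD (hist lam k n) 0

a : (ℕ → ℕ) → ℕ → ℤ → ℕ
a lam k (+ n)    = aℕ lam k n
a lam k -[1+ n ] = 1

-- A digit sequence d_M … d_0 is a vector v of length M+1 with  d_i = lookup v i
-- (so the vector lists d_0 first).
Valid : (lam : ℕ → ℕ) (k M : ℕ) → Vec (Fin (LamTot lam k)) (suc M) → Set
Valid lam k M v =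
  (¬ (toℕ (lookup v (fromℕ M)) ≡ 0)) ×
  (∀ (i j : Fin (suc M)) → toℕ i < toℕ j →
     toℕ j < toℕ i + μ lam k (toℕ (lookup v i)) → toℕ (lookup v j) ≡ 0)

valid? : (lam : ℕ → ℕ) (k M : ℕ) (v : Vec (Fin (LamTot lam k)) (suc M)) → Dec (Valid lam k M v)
valid? lam k M v =
  ¬? (toℕ (lookup v (fromℕ M)) ≟ 0) ×-dec
  all? (λ i → all? (λ j → (toℕ i <? toℕ j) →-dec
     ((toℕ j <? toℕ i + μ lam k (toℕ (lookup v i))) →-dec (toℕ (lookup v j) ≟ 0))))

allVecs : (b n : ℕ) → List (Vec (Fin b) n)
allVecs b zero    = [ [] ]
allVecs b (suc n) = concatMap (λ x → map (x ∷_) (allVecs b n)) (allFin b)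

countLen : (lam : ℕ → ℕ) (k M : ℕ) → ℕ
countLen lam k M = length (filter (valid? lam k M) (allVecs (LamTot lam k) (suc M)))

countUpTo : (lam : ℕ → ℕ) (k n : ℕ) → ℕ
countUpTo lam k zero    = 0
countUpTo lam k (suc n) = countUpTo lam k n + countLen lam k n

count : (lam : ℕ → ℕ) (k : ℕ) → ℤ → ℕ
count lam k (+ n)    = countUpTo lam k n
count lam k -[1+ n ] = 0

-- Call a digit string d_0 … d_(n-1) (leading zeros allowed) padded if every digit ℓ is
-- followed, towards the top, by μ_ℓ - 1 zeros, and let N n be the number of padded strings of
-- length n.  Splitting off d_0 = ℓ leaves a padded string of length n that starts with
-- μ_ℓ - 1 zeros; as μ_0 = 1, zeros may be stripped freely, so there are N (n + 1 - μ_ℓ) of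
-- them.  Exactly λ_i digits ℓ (those with Λ_(i-1) ≤ ℓ < Λ_i) have μ_ℓ = i, hence
-- N (n + 1) = Σ_i λ_i N (n + 1 - i), the recurrence of a (with N 0 = 1 playing the role of
-- a_j = 1 for j ≤ 0), so N = a.  A padded string of length M + 1 is either valid or a
-- padded string of length M followed by a zero; summing over M, the valid sequences with at
-- most t digits number N t - 1.

module Submission where

open import Defs
open import Data.Bool using (true; false; T)
open import Data.Empty using (⊥-elim)
open import Data.Fin using (Fin; toℕ; fromℕ) renaming (zero to fzero; suc to fsuc)
open import Data.Integer using (ℤ; -[1+_])
import Data.Integer as ℤ
open import Data.List using (List; []; _∷_; [_]; length; filter; map; concatMap; allFin; tabulate; _++_)
open import Data.List.Properties using (filter-≐; filter-++; filter-none; length-++; map-tabulate; tabulate-cong)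
import Data.List.Relation.Unary.All as All
open import Data.Nat using (ℕ; zero; suc; _+_; _*_; _∸_; _≤_; _<_; z≤n; s≤s; _≟_; _<ᵇ_)
open import Data.Nat.Induction using (<-rec)
open import Data.Nat.ListAction using (sum)
open import Data.Nat.Properties
open import Data.Product using (_×_; _,_; proj₁; proj₂)
open import Data.Sum using (inj₁; inj₂)
open import Data.Unit using (⊤; tt)
open import Data.Vec using (Vec; []; _∷_; lookup; _∷ʳ_)
open import Function using (_∘_; id)
open import Relation.Nullary using (yes; no; ¬_; _×-dec_)
open import Relation.Unary using (Decidable; _≐_)
open import Relation.Unary.Properties using (_∩?_; ∁?)
open import Relation.Binary.PropositionalEquality hiding ([_])

infix 10 #[_]_

#[_]_ : {A : Set} {P : A → Set} → Decidable P → List A → ℕ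
#[ P? ] xs = length (filter P? xs)

module _ {A : Set} {P : A → Set} (P? : Decidable P) where

  #-++ : ∀ xs ys → #[ P? ] (xs ++ ys) ≡ #[ P? ] xs + #[ P? ] ys
  #-++ xs ys = trans (cong length (filter-++ P? xs ys)) (length-++ (filter P? xs))

  #-none : (∀ x → ¬ P x) → ∀ xs → #[ P? ] xs ≡ 0
  #-none ¬P xs = cong length (filter-none P? (All.universal ¬P xs))

  #-map : {B : Set} (f : B → A) → ∀ xs → #[ P? ] (map f xs) ≡ #[ P? ∘ f ] xs
  #-map f [] = refl
  #-map f (x ∷ xs) with P? (f x)
  ... | yes _ = cong suc (#-map f xs)
  ... | no _  = #-map f xs

  #-concatMap : {B : Set} (g : B → List A) → ∀ xs →
    #[ P? ] (concatMap g xs) ≡ sum (map (λ x → #[ P? ] (g x)) xs)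
  #-concatMap g [] = refl
  #-concatMap g (x ∷ xs) =
    trans (#-++ (g x) (concatMap g xs)) (cong (#[ P? ] (g x) +_) (#-concatMap g xs))

module _ {A : Set} {P Q : A → Set} (P? : Decidable P) (Q? : Decidable Q) where

  #-≐ : P ≐ Q → ∀ xs → #[ P? ] xs ≡ #[ Q? ] xs
  #-≐ P≐Q xs = cong length (filter-≐ P? Q? P≐Q xs)

  #-∩-∁ : ∀ xs → #[ P? ] xs ≡ #[ P? ∩? Q? ] xs + #[ P? ∩? ∁? Q? ] xs
  #-∩-∁ [] = refl
  #-∩-∁ (x ∷ xs) with P? x | Q? x
  ... | yes _ | yes _ = cong suc (#-∩-∁ xs)
  ... | yes _ | no _  = trans (cong suc (#-∩-∁ xs)) (sym (+-suc _ _))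
  ... | no _  | _     = #-∩-∁ xs

∑< : ℕ → (ℕ → ℕ) → ℕ
∑< zero    g = 0
∑< (suc b) g = g 0 + ∑< b (g ∘ suc)

∑<-cong : ∀ b {g h : ℕ → ℕ} → (∀ ℓ → ℓ < b → g ℓ ≡ h ℓ) → ∑< b g ≡ ∑< b h
∑<-cong zero    g≡h = refl
∑<-cong (suc b) g≡h = cong₂ _+_ (g≡h 0 (s≤s z≤n)) (∑<-cong b (λ ℓ ℓ<b → g≡h (suc ℓ) (s≤s ℓ<b)))

∑<-+ : ∀ p q (g : ℕ → ℕ) → ∑< (p + q) g ≡ ∑< p g + ∑< q (g ∘ (p +_))
∑<-+ zero    q g = refl
∑<-+ (suc p) q g = trans (cong (g 0 +_) (∑<-+ p q (g ∘ suc))) (sym (+-assoc (g 0) _ _))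

∑<-const : ∀ q c → ∑< q (λ _ → c) ≡ q * c
∑<-const zero    c = refl
∑<-const (suc q) c = cong (c +_) (∑<-const q c)

∑<-recurrence-unique : ∀ b (d : ℕ → ℕ) {f g : ℕ → ℕ} → f 0 ≡ g 0 →
  (∀ n → f (suc n) ≡ ∑< b (λ ℓ → f (n ∸ d ℓ))) →
  (∀ n → g (suc n) ≡ ∑< b (λ ℓ → g (n ∸ d ℓ))) → ∀ n → f n ≡ g n
∑<-recurrence-unique b d {f} {g} f0≡g0 f-suc g-suc = <-rec (λ n → f n ≡ g n) step
  where
  step : ∀ n → (∀ {i} → i < n → f i ≡ g i) → f n ≡ g n
  step zero    _  = f0≡g0
  step (suc n) ih = begin
    f (suc n)                     ≡⟨ f-suc n ⟩
    ∑< b (λ ℓ → f (n ∸ d ℓ))     ≡⟨ ∑<-cong b (λ ℓ _ → ih (s≤s (m∸n≤m n (d ℓ)))) ⟩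
    ∑< b (λ ℓ → g (n ∸ d ℓ))     ≡⟨ g-suc n ⟨
    g (suc n)                     ∎
    where open ≡-Reasoning

sum-tabulate : ∀ b {g : ℕ → ℕ} {h : Fin b → ℕ} → (∀ x → h x ≡ g (toℕ x)) →
  sum (tabulate h) ≡ ∑< b g
sum-tabulate zero    h≡g = refl
sum-tabulate (suc b) h≡g = cong₂ _+_ (h≡g fzero) (sum-tabulate b (h≡g ∘ fsuc))

sum-tabulate-head : ∀ c (h : Fin (suc c) → ℕ) → (∀ x → h (fsuc x) ≡ 0) → sum (tabulate h) ≡ h fzero
sum-tabulate-head c h tail≡0 = begin
  h fzero + sum (tabulate (h ∘ fsuc)) ≡⟨ cong (h fzero +_) (sum-tabulate c tail≡0) ⟩
  h fzero + ∑< c (λ _ → 0)             ≡⟨ cong (h fzero +_) (trans (∑<-const c 0) (*-zeroʳ c)) ⟩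
  h fzero + 0                          ≡⟨ +-identityʳ (h fzero) ⟩
  h fzero                              ∎
  where open ≡-Reasoning

topZero? : ∀ {b} M → Decidable (λ (v : Vec (Fin b) (suc M)) → toℕ (lookup v (fromℕ M)) ≡ 0)
topZero? M v = toℕ (lookup v (fromℕ M)) ≟ 0

#-allVecs-suc : ∀ b n {P : Vec (Fin b) (suc n) → Set} (P? : Decidable P) →
  #[ P? ] (allVecs b (suc n)) ≡ sum (tabulate (λ x → #[ P? ∘ (x ∷_) ] (allVecs b n)))
#-allVecs-suc b n P? = trans (#-concatMap P? (λ x → map (x ∷_) (allVecs b n)) (allFin b))
  (cong sum (trans (map-tabulate id _) (tabulate-cong (λ x → #-map P? (x ∷_) (allVecs b n)))))

#-allVecs-topZero : ∀ c M {Q : Vec (Fin (suc c)) (suc M) → Set} (Q? : Decidable Q) →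
  #[ Q? ∩? topZero? M ] (allVecs (suc c) (suc M)) ≡ #[ Q? ∘ (_∷ʳ fzero) ] (allVecs (suc c) M)
#-allVecs-topZero c zero Q? = begin
  #[ P? ] (allVecs (suc c) 1)
    ≡⟨ #-allVecs-suc (suc c) 0 P? ⟩
  sum (tabulate (λ x → #[ P? ∘ (x ∷_) ] [ [] ]))
    ≡⟨ sum-tabulate-head c (λ x → #[ P? ∘ (x ∷_) ] [ [] ])
         (λ x → #-none (P? ∘ (fsuc x ∷_)) (λ { [] (_ , ()) }) [ [] ]) ⟩
  #[ P? ∘ (fzero ∷_) ] [ [] ]
    ≡⟨ #-≐ (P? ∘ (fzero ∷_)) (Q? ∘ (_∷ʳ fzero))
         ((λ { {[]} (q , _) → q }) , (λ { {[]} q → q , refl })) [ [] ] ⟩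
  #[ Q? ∘ (_∷ʳ fzero) ] [ [] ] ∎
  where
  open ≡-Reasoning
  P? = Q? ∩? topZero? 0
#-allVecs-topZero c (suc M) Q? =
  trans (#-allVecs-suc (suc c) (suc M) _)
    (trans (cong sum (tabulate-cong (λ x → #-allVecs-topZero c M (Q? ∘ (x ∷_)))))
      (sym (#-allVecs-suc (suc c) M _)))

module Padding (m : ℕ → ℕ) where

  ZeroPrefix : ∀ {b n} → ℕ → Vec (Fin b) n → Set
  ZeroPrefix zero    v       = ⊤
  ZeroPrefix (suc p) []      = ⊤
  ZeroPrefix (suc p) (x ∷ v) = toℕ x ≡ 0 × ZeroPrefix p v

  Padded : ∀ {b n} → Vec (Fin b) n → Set
  Padded []      = ⊤
  Padded (x ∷ v) = ZeroPrefix (m (toℕ x) ∸ 1) v × Padded v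

  IndexPadded : ∀ {b n} → Vec (Fin b) n → Set
  IndexPadded v = ∀ i j → toℕ i < toℕ j → toℕ j < toℕ i + m (toℕ (lookup v i)) →
    toℕ (lookup v j) ≡ 0

  ValidDigits : ∀ {b} M → Vec (Fin b) (suc M) → Set
  ValidDigits M v = (¬ toℕ (lookup v (fromℕ M)) ≡ 0) × IndexPadded v

  zeroPrefix? : ∀ {b n} p → Decidable (ZeroPrefix {b} {n} p)
  zeroPrefix? zero    v       = yes tt
  zeroPrefix? (suc p) []      = yes tt
  zeroPrefix? (suc p) (x ∷ v) = (toℕ x ≟ 0) ×-dec zeroPrefix? p v

  padded? : ∀ {b n} → Decidable (Padded {b} {n})
  padded? []      = yes tt
  padded? (x ∷ v) = zeroPrefix? (m (toℕ x) ∸ 1) v ×-dec padded? v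

  zeroPrefix⇒lookup≡0 : ∀ {b n} p (v : Vec (Fin b) n) → ZeroPrefix p v →
    ∀ j → toℕ j < p → toℕ (lookup v j) ≡ 0
  zeroPrefix⇒lookup≡0 (suc p) (x ∷ v) (x≡0 , _)  fzero    _         = x≡0
  zeroPrefix⇒lookup≡0 (suc p) (x ∷ v) (_ , zp)   (fsuc j) (s≤s j<p) = zeroPrefix⇒lookup≡0 p v zp j j<p

  lookup≡0⇒zeroPrefix : ∀ {b n} p (v : Vec (Fin b) n) →
    (∀ j → toℕ j < p → toℕ (lookup v j) ≡ 0) → ZeroPrefix p v
  lookup≡0⇒zeroPrefix zero    v       _    = tt
  lookup≡0⇒zeroPrefix (suc p) []      _    = tt
  lookup≡0⇒zeroPrefix (suc p) (x ∷ v) all0 = all0 fzero (s≤s z≤n) ,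
    lookup≡0⇒zeroPrefix p v (λ j j<p → all0 (fsuc j) (s≤s j<p))

  padded⇒indexPadded : ∀ {b n} (v : Vec (Fin b) n) → Padded v → IndexPadded v
  padded⇒indexPadded (x ∷ v) (zp , _) fzero (fsuc j) _ j<m =
    zeroPrefix⇒lookup≡0 _ v zp j (∸-monoˡ-< j<m (s≤s z≤n))
  padded⇒indexPadded (x ∷ v) (_ , pv) (fsuc i) (fsuc j) (s≤s i<j) (s≤s j<i+m) =
    padded⇒indexPadded v pv i j i<j j<i+m

  indexPadded⇒padded : ∀ {b n} (v : Vec (Fin b) n) → IndexPadded v → Padded v
  indexPadded⇒padded []      _  = tt
  indexPadded⇒padded (x ∷ v) ip =
    lookup≡0⇒zeroPrefix _ v (λ j j<m → ip fzero (fsuc j) (s≤s z≤n) (<∸1⇒suc< (m (toℕ x)) j<m)) ,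
    indexPadded⇒padded v (λ i j i<j j<i+m → ip (fsuc i) (fsuc j) (s≤s i<j) (s≤s j<i+m))
    where
    <∸1⇒suc< : ∀ {j} q → j < q ∸ 1 → suc j < q
    <∸1⇒suc< (suc q) j<q = s≤s j<q

  zeroPrefix-∷ʳ0 : ∀ {b n} p (u : Vec (Fin (suc b)) n) → ZeroPrefix p u → ZeroPrefix p (u ∷ʳ fzero)
  zeroPrefix-∷ʳ0 zero    u       _         = tt
  zeroPrefix-∷ʳ0 (suc p) []      _         = refl , lookup≡0⇒zeroPrefix p [] (λ ())
  zeroPrefix-∷ʳ0 (suc p) (x ∷ u) (x≡0 , zp) = x≡0 , zeroPrefix-∷ʳ0 p u zp

  ∷ʳ-zeroPrefix : ∀ {b n} p (u : Vec (Fin b) n) z → ZeroPrefix p (u ∷ʳ z) → ZeroPrefix p u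
  ∷ʳ-zeroPrefix zero    u       z _          = tt
  ∷ʳ-zeroPrefix (suc p) []      z _          = tt
  ∷ʳ-zeroPrefix (suc p) (x ∷ u) z (x≡0 , zp) = x≡0 , ∷ʳ-zeroPrefix p u z zp

  padded-∷ʳ0 : ∀ {b n} → Padded {suc b} {n} ≐ (Padded ∘ (_∷ʳ fzero))
  padded-∷ʳ0 = (λ {u} → to u) , (λ {u} → from u)
    where
    to : ∀ {b n} (u : Vec (Fin (suc b)) n) → Padded u → Padded (u ∷ʳ fzero)
    to []      _         = lookup≡0⇒zeroPrefix _ [] (λ ()) , tt
    to (x ∷ u) (zp , pu) = zeroPrefix-∷ʳ0 _ u zp , to u pu
    from : ∀ {b n} (u : Vec (Fin (suc b)) n) → Padded (u ∷ʳ fzero) → Padded u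
    from []      _         = tt
    from (x ∷ u) (zp , pu) = ∷ʳ-zeroPrefix _ u fzero zp , from u pu

  #Padded : ℕ → ℕ → ℕ
  #Padded b n = #[ padded? ] (allVecs b n)

  #zeroPrefix-padded : m 0 ≤ 1 → ∀ c p n →
    #[ zeroPrefix? p ∩? padded? ] (allVecs (suc c) n) ≡ #Padded (suc c) (n ∸ p)
  #zeroPrefix-padded m0≤1 c zero n =
    #-≐ (zeroPrefix? 0 ∩? padded?) padded? ((λ (_ , pv) → pv) , (λ pv → tt , pv)) (allVecs (suc c) n)
  #zeroPrefix-padded m0≤1 c (suc p) zero = refl
  #zeroPrefix-padded m0≤1 c (suc p) (suc n) = begin
    #[ zeroPrefix? (suc p) ∩? padded? ] (allVecs (suc c) (suc n))
      ≡⟨ #-allVecs-suc (suc c) n (zeroPrefix? (suc p) ∩? padded?) ⟩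
    sum (tabulate F)
      ≡⟨ sum-tabulate-head c F (λ x → #-none ((zeroPrefix? (suc p) ∩? padded?) ∘ (fsuc x ∷_))
                                             (λ { _ (() , _) }) (allVecs (suc c) n)) ⟩
    F fzero
      ≡⟨ #-≐ ((zeroPrefix? (suc p) ∩? padded?) ∘ (fzero ∷_)) (zeroPrefix? p ∩? padded?)
             ((λ ((_ , zp) , (_ , pv)) → zp , pv) , (λ (zp , pv) → (refl , zp) , (zeroPrefix-m0 _ , pv)))
             (allVecs (suc c) n) ⟩
    #[ zeroPrefix? p ∩? padded? ] (allVecs (suc c) n)
      ≡⟨ #zeroPrefix-padded m0≤1 c p n ⟩
    #Padded (suc c) (n ∸ p) ∎
    where
    open ≡-Reasoning
    F : Fin (suc c) → ℕ
    F x = #[ (zeroPrefix? (suc p) ∩? padded?) ∘ (x ∷_) ] (allVecs (suc c) n)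
    zeroPrefix-m0 : (v : Vec (Fin (suc c)) n) → ZeroPrefix (m 0 ∸ 1) v
    zeroPrefix-m0 v = subst (λ q → ZeroPrefix q v) (sym (m≤n⇒m∸n≡0 m0≤1)) tt

  #Padded-suc : m 0 ≤ 1 → ∀ b n → #Padded b (suc n) ≡ ∑< b (λ ℓ → #Padded b (n ∸ (m ℓ ∸ 1)))
  #Padded-suc m0≤1 zero    n = refl
  #Padded-suc m0≤1 (suc c) n = trans (#-allVecs-suc (suc c) n padded?)
    (sum-tabulate (suc c) {λ ℓ → #Padded (suc c) (n ∸ (m ℓ ∸ 1))}
      (λ x → #zeroPrefix-padded m0≤1 c (m (toℕ x) ∸ 1) n))

  #Padded-top : ∀ b → 1 ≤ b → ∀ M (valid? : Decidable (ValidDigits {b} M)) →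
    #Padded b (suc M) ≡ #Padded b M + #[ valid? ] (allVecs b (suc M))
  #Padded-top (suc c) _ M valid? = begin
    #[ padded? ] vs
      ≡⟨ #-∩-∁ padded? (topZero? M) vs ⟩
    #[ padded? ∩? topZero? M ] vs + #[ padded? ∩? ∁? (topZero? M) ] vs
      ≡⟨ cong₂ _+_ (#-allVecs-topZero c M padded?)
                   (#-≐ (padded? ∩? ∁? (topZero? M)) valid? padded-topNonzero⇔valid vs) ⟩
    #[ padded? ∘ (_∷ʳ fzero) ] (allVecs (suc c) M) + #[ valid? ] vs
      ≡⟨ cong (_+ #[ valid? ] vs)
              (#-≐ (padded? ∘ (_∷ʳ fzero)) padded? (proj₂ padded-∷ʳ0 , proj₁ padded-∷ʳ0)
                   (allVecs (suc c) M)) ⟩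
    #[ padded? ] (allVecs (suc c) M) + #[ valid? ] vs ∎
    where
    open ≡-Reasoning
    vs : List (Vec (Fin (suc c)) (suc M))
    vs = allVecs (suc c) (suc M)
    padded-topNonzero⇔valid : (λ v → Padded v × ¬ toℕ (lookup v (fromℕ M)) ≡ 0) ≐ ValidDigits M
    padded-topNonzero⇔valid =
      (λ (pv , top≢0) → top≢0 , padded⇒indexPadded _ pv) ,
      (λ (top≢0 , ip) → indexPadded⇒padded _ ip , top≢0)

μ-search-≡ : ∀ (L : ℕ → ℕ) ℓ {j*} fuel j → j ≤ j* → j* ≤ j + fuel →
  (∀ {i} → i < j* → L i ≤ ℓ) → ℓ < L j* → μ-search L ℓ j fuel ≡ j*
μ-search-≡ L ℓ zero j j≤j* j*≤j+0 _ _ = ≤-antisym j≤j* (subst (_ ≤_) (+-identityʳ j) j*≤j+0)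
μ-search-≡ L ℓ {j*} (suc fuel) j j≤j* j*≤j+fuel below above with ℓ <ᵇ L j in eq | j ≟ j*
... | true  | yes j≡j* = j≡j*
... | true  | no  j≢j* =
  ⊥-elim (<⇒≱ (<ᵇ⇒< ℓ (L j) (subst T (sym eq) tt)) (below (≤∧≢⇒< j≤j* j≢j*)))
... | false | yes refl = ⊥-elim (subst T eq (<⇒<ᵇ above))
... | false | no  j≢j* =
  μ-search-≡ L ℓ fuel (suc j) (≤∧≢⇒< j≤j* j≢j*) (subst (j* ≤_) (+-suc j fuel) j*≤j+fuel) below above

sumTo-mono : ∀ (f : ℕ → ℕ) {i j} → i ≤ j → sumTo f i ≤ sumTo f j
sumTo-mono f {j = zero}  z≤n = ≤-refl
sumTo-mono f {j = suc j} i≤1+j with m≤n⇒m<n∨m≡n i≤1+j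
... | inj₁ i<1+j = ≤-trans (sumTo-mono f (≤-pred i<1+j)) (m≤m+n (sumTo f j) (f (suc j)))
... | inj₂ refl  = ≤-refl

module _ (lam : ℕ → ℕ) (k : ℕ) where

  open Padding (μ lam k)

  μ≡ : ∀ j ℓ → suc j ≤ k → Lam lam j ≤ ℓ → ℓ < Lam lam (suc j) → μ lam k ℓ ≡ suc j
  μ≡ j ℓ 1+j≤k Λⱼ≤ℓ ℓ<Λ₁₊ⱼ = μ-search-≡ (Lam lam) ℓ k 0 z≤n 1+j≤k
    (λ i<1+j → ≤-trans (sumTo-mono lam (≤-pred i<1+j)) Λⱼ≤ℓ) ℓ<Λ₁₊ⱼ

  ∑<-μ : ∀ (f : ℕ → ℕ) j → j ≤ k → ∑< (Lam lam j) (f ∘ μ lam k) ≡ sumTo (λ i → lam i * f i) j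
  ∑<-μ f zero    _     = refl
  ∑<-μ f (suc j) 1+j≤k = begin
    ∑< (Lam lam j + lam (suc j)) (f ∘ μ lam k)
      ≡⟨ ∑<-+ (Lam lam j) (lam (suc j)) (f ∘ μ lam k) ⟩
    ∑< (Lam lam j) (f ∘ μ lam k) + ∑< (lam (suc j)) (f ∘ μ lam k ∘ (Lam lam j +_))
      ≡⟨ cong₂ _+_ (∑<-μ f j (≤-trans (n≤1+n j) 1+j≤k)) (∑<-cong (lam (suc j)) μ≡1+j) ⟩
    sumTo (λ i → lam i * f i) j + ∑< (lam (suc j)) (λ _ → f (suc j))
      ≡⟨ cong (sumTo (λ i → lam i * f i) j +_) (∑<-const (lam (suc j)) (f (suc j))) ⟩
    sumTo (λ i → lam i * f i) j + lam (suc j) * f (suc j) ∎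
    where
    open ≡-Reasoning
    μ≡1+j : ∀ ℓ → ℓ < lam (suc j) → f (μ lam k (Lam lam j + ℓ)) ≡ f (suc j)
    μ≡1+j ℓ ℓ<λ = cong f (μ≡ j (Lam lam j + ℓ) 1+j≤k (m≤m+n _ ℓ) (+-monoʳ-< (Lam lam j) ℓ<λ))

  lookupD-hist : ∀ n j → lookupD (hist lam k n) j ≡ aℕ lam k (n ∸ j)
  lookupD-hist zero    zero    = refl
  lookupD-hist zero    (suc j) = refl
  lookupD-hist (suc n) zero    = refl
  lookupD-hist (suc n) (suc j) = lookupD-hist n j

  aℕ-suc : ∀ n → aℕ lam k (suc n) ≡ ∑< (LamTot lam k) (λ ℓ → aℕ lam k (n ∸ (μ lam k ℓ ∸ 1)))
  aℕ-suc n = begin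
    sumTo (λ i → lam i * lookupD (hist lam k n) (i ∸ 1)) k
      ≡⟨ sumTo-cong k (λ i → cong (lam i *_) (lookupD-hist n (i ∸ 1))) ⟩
    sumTo (λ i → lam i * aℕ lam k (n ∸ (i ∸ 1))) k
      ≡⟨ ∑<-μ (λ i → aℕ lam k (n ∸ (i ∸ 1))) k ≤-refl ⟨
    ∑< (LamTot lam k) (λ ℓ → aℕ lam k (n ∸ (μ lam k ℓ ∸ 1))) ∎
    where
    open ≡-Reasoning
    sumTo-cong : ∀ j {f g : ℕ → ℕ} → (∀ i → f i ≡ g i) → sumTo f j ≡ sumTo g j
    sumTo-cong zero    f≡g = refl
    sumTo-cong (suc j) f≡g = cong₂ _+_ (sumTo-cong j f≡g) (f≡g (suc j))

  aℕ≡#Padded : 1 ≤ k → 1 ≤ lam 1 → ∀ n → aℕ lam k n ≡ #Padded (LamTot lam k) n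
  aℕ≡#Padded 1≤k 1≤λ₁ = ∑<-recurrence-unique (LamTot lam k) (λ ℓ → μ lam k ℓ ∸ 1) refl
    aℕ-suc (#Padded-suc (≤-reflexive (μ≡ 0 0 1≤k z≤n 1≤λ₁)) (LamTot lam k))

  suc-countUpTo≡#Padded : 1 ≤ k → 1 ≤ lam 1 → ∀ n → suc (countUpTo lam k n) ≡ #Padded (LamTot lam k) n
  suc-countUpTo≡#Padded 1≤k 1≤λ₁ zero    = refl
  suc-countUpTo≡#Padded 1≤k 1≤λ₁ (suc n) =
    trans (cong (_+ countLen lam k n) (suc-countUpTo≡#Padded 1≤k 1≤λ₁ n))
      (sym (#Padded-top (LamTot lam k) (≤-trans 1≤λ₁ (sumTo-mono lam 1≤k)) n (valid? lam k n)))

proposition4p3 : (lam : ℕ → ℕ) (k : ℕ) → 1 ≤ k → 1 ≤ lam 1 → 1 ≤ lam k →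
    (∀ i → k < i → lam i ≡ 0) → (k ≡ 1 → 2 ≤ lam 1) →
    (t : ℤ) → count lam k t ≡ a lam k t ∸ 1
proposition4p3 lam k 1≤k 1≤λ₁ _ _ _ -[1+ n ] = refl
proposition4p3 lam k 1≤k 1≤λ₁ _ _ _ (ℤ.+ n) = cong (_∸ 1) (begin
  suc (countUpTo lam k n)                     ≡⟨ suc-countUpTo≡#Padded lam k 1≤k 1≤λ₁ n ⟩
  Padding.#Padded (μ lam k) (LamTot lam k) n  ≡⟨ aℕ≡#Padded lam k 1≤k 1≤λ₁ n ⟨
  aℕ lam k n                                  ∎)
  where open ≡-Reasoning
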